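{- Let $s \ge 2$ and $k \ge 0$ be integers with $s(k+1)$ even, and let $T$ be any tournament constructed as follows. $V(T)$ is partitioned into $V_1, V_2, V_3$ with $|V_1| = s(k+1)-1$, $|V_2| = s(k+1)$, $|V_3| = s(k+1)+1$, and each $T[V_i]$ is a semi-regular tournament. All edges between $V_1$ and $V_2$ are oriented from $V_1$ to $V_2$. The edges between $V_2$ and $V_3$ that are not oriented from $V_2$ to $V_3$ form a matching $M_1$, and the edges between $V_1$ and $V_3$ that are not oriented from $V_3$ to $V_1$ form a matching $M_2$, such that $V(M_1)\cap V_3 = V(M_2)\cap V_3$, $|V(M_1)\cap V_2| = |V(M_1)\cap V_3| = |V(M_2)\cap V_1| = s(k+1)/2$, and $V(M_1)\cap V_2$ is the set of vertices of $V_2$ with the highest out-degree in $T[V_2]$. Then $T$ does not contain a perfect $D_s$-tiling.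
   Context: An oriented graph is a loopless directed graph with at most one of $uv$, $vu$ for each pair of distinct vertices; a tournament has exactly one. An oriented graph $G$ on $n$ vertices with minimum semi-degree (minimum of all in- and out-degrees) equal to $\lfloor (n-1)/2\rfloor$ is a semi-regular tournament. For $s \ge 1$, $D_s$ is the tournament on $3s$ vertices whose vertex set is partitioned into three sets $A,B,C$ of size $s$, each inducing a transitive tournament, with all edges between distinct parts oriented from $A$ to $B$, from $B$ to $C$, and from $C$ to $A$. A perfect $D_s$-tiling of $T$ is a collection of vertex-disjoint copies of $D_s$ in $T$ covering all vertices of $T$. -}

module Defs where

open import Data.Nat using (ℕ; zero; suc; _+_; _*_; _∸_; _≤_; _<_)
open import Data.Nat.DivMod using (_/_)
open import Data.Nat.Divisibility using (_∣_)
open import Data.Bool using (Bool; true; false; _∧_; _∨_)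
open import Data.Fin using (Fin; zero; suc; _≟_)
import Data.Fin as F
open import Data.Fin.Subset using (Subset; _∈_; _∩_; ∣_∣)
open import Data.Vec using (Vec; []; _∷_; tabulate)
open import Data.Product using (Σ; ∃; ∃-syntax; _×_; _,_)
open import Data.Sum using (_⊎_)
open import Relation.Binary.PropositionalEquality using (_≡_; _≢_)
open import Relation.Nullary.Decidable using (⌊_⌋)
open import Function.Definitions using (Injective)

-- A digraph on vertex set Fin n given by a Boolean adjacency function:
-- adj u v ≡ true  means that uv (u → v) is an edge.
Adj : ℕ → Set
Adj n = Fin n → Fin n → Bool

record IsTournament {n : ℕ} (adj : Adj n) : Set where
  field
    loopless : ∀ v → adj v v ≡ false
    antisym  : ∀ u v → adj u v ≡ true → adj v u ≡ false
    total    : ∀ u v → u ≢ v → adj u v ≡ true ⊎ adj v u ≡ true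

outNbr : {n : ℕ} → Adj n → Fin n → Subset n
outNbr adj v = tabulate (adj v)

inNbr : {n : ℕ} → Adj n → Fin n → Subset n
inNbr adj v = tabulate (λ u → adj u v)

outDegIn : {n : ℕ} → Adj n → Subset n → Fin n → ℕ
outDegIn adj S v = ∣ S ∩ outNbr adj v ∣

inDegIn : {n : ℕ} → Adj n → Subset n → Fin n → ℕ
inDegIn adj S v = ∣ S ∩ inNbr adj v ∣

MinSemiDegIs : {n : ℕ} → Adj n → Subset n → ℕ → Set
MinSemiDegIs adj S d =
  (∀ v → v ∈ S → d ≤ outDegIn adj S v × d ≤ inDegIn adj S v)
  × (∃[ v ] (v ∈ S × (outDegIn adj S v ≡ d ⊎ inDegIn adj S v ≡ d)))

-- T[S] is semi-regular: minimum semi-degree ⌊(|S|-1)/2⌋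
-- (T[S] is a tournament whenever T is)
SemiRegularOn : {n : ℕ} → Adj n → Subset n → Set
SemiRegularOn adj S = MinSemiDegIs adj S ((∣ S ∣ ∸ 1) / 2)

nonEmptyᵇ : {n : ℕ} → Subset n → Bool
nonEmptyᵇ []       = false
nonEmptyᵇ (b ∷ bs) = b ∨ nonEmptyᵇ bs

partSet : {n : ℕ} → (Fin n → Fin 3) → Fin 3 → Subset n
partSet p i = tabulate (λ v → ⌊ p v ≟ i ⌋)

EdgesFormMatching : {n : ℕ} → Adj n → Subset n → Subset n → Set
EdgesFormMatching adj A B =
  (∀ a b b' → a ∈ A → b ∈ B → b' ∈ B →
     adj a b ≡ true → adj a b' ≡ true → b ≡ b')
  × (∀ a a' b → a ∈ A → a' ∈ A → b ∈ B →
     adj a b ≡ true → adj a' b ≡ true → a ≡ a')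

tailsFromTo : {n : ℕ} → Adj n → Subset n → Subset n → Subset n
tailsFromTo adj A B = A ∩ tabulate (λ a → nonEmptyᵇ (B ∩ outNbr adj a))

headsFromTo : {n : ℕ} → Adj n → Subset n → Subset n → Subset n
headsFromTo adj A B = B ∩ tabulate (λ b → nonEmptyᵇ (A ∩ inNbr adj b))

-- D_s on vertex set Fin 3 × Fin s: parts A = 0, B = 1, C = 2;
-- each part a transitive tournament (i → j iff i < j); A → B → C → A.
next3 : Fin 3 → Fin 3
next3 zero             = suc zero
next3 (suc zero)       = suc (suc zero)
next3 (suc (suc zero)) = zero

DEdge : (s : ℕ) → Fin 3 × Fin s → Fin 3 × Fin s → Set
DEdge s (p , i) (q , j) = (p ≡ q × i F.< j) ⊎ q ≡ next3 p

-- A copy of D_s in T: an injective map preserving edges (T and D_s are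
-- tournaments, so this is an isomorphism onto the induced subtournament).
IsCopyOfD : {n : ℕ} → Adj n → (s : ℕ) → (Fin 3 × Fin s → Fin n) → Set
IsCopyOfD adj s f =
  Injective _≡_ _≡_ f × (∀ x y → DEdge s x y → adj (f x) (f y) ≡ true)

HasPerfectDTiling : {n : ℕ} → Adj n → ℕ → Set
HasPerfectDTiling {n} adj s =
  Σ ℕ λ t → Σ (Fin t → Fin 3 × Fin s → Fin n) λ g →
    (∀ a → IsCopyOfD adj s (g a))
    × (∀ a b x y → g a x ≡ g b y → a ≡ b)
    × (∀ v → ∃[ a ] ∃[ x ] (g a x ≡ v))

-- Give the vertices of V₁, V₂, V₃ the weights 1, 2, 0. With N = s(k+1), T has total weight
-- (N − 1) + 2N ≡ 2 (mod 3), whereas every copy of D_s in T has weight ≡ 0 (mod 3), so no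
-- perfect D_s-tiling exists. For a copy with parts A → B → C → A, edges of D_s between
-- consecutive parts may not run from V₂ to V₁, and those from V₁ to V₃ or from V₃ to V₂ span
-- complete bipartite graphs inside a matching. If the copy avoids V₁ (or V₂), this forces its
-- parts to meet V₂ (or V₁) in equally many vertices, namely 0, 1 or s each. Otherwise, up to
-- rotation, B ⊆ V₃, A ⊆ V₂ ∪ V₃, C ⊆ V₁ ∪ V₃ and |A ∩ V₂| = |C ∩ V₁|.
module Submission where

open import Defs
open import Data.Bool using (true)
open import Data.Nat using (ℕ; zero; suc; _+_; _*_; _∸_; _≤_; _<_; z≤n; s≤s; z<s)
open import Data.Nat.DivMod using (_/_)
open import Data.Nat.Divisibility using (_∣_; divides; m∣m*n; ∣m∣n⇒∣m+n; ∣m+n∣m⇒∣n; ∣⇒≤)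
open import Data.Nat.Properties
  using (+-identityʳ; +-assoc; +-comm; +-suc; ≤-reflexive; ≤-trans; <⇒≱; ≮⇒≥; n≤0⇒n≡0; m≤m*n;
         +-0-commutativeMonoid)
open import Data.Nat.Tactic.RingSolver using (solve-∀)
open import Data.Fin using (Fin; zero; suc; _↑ˡ_; _↑ʳ_; combine; remQuot)
open import Data.Fin.Patterns using (0F; 1F; 2F)
open import Data.Fin.Properties using (suc-injective; remQuot-combine; *↔×)
open import Data.Fin.Subset using (Subset; inside; outside; _∈_; ∣_∣; Nonempty; Empty)
open import Data.Fin.Subset.Properties using (nonempty?; Empty-unique; ∣⊥∣≡0)
open import Data.Vec using ([]; _∷_; here; there)
open import Data.Vec.Properties using (lookup∘tabulate; lookup⇒[]=; []=⇒lookup)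
open import Data.Bool.Properties using (T-≡)
open import Data.Product using (_×_; _,_; proj₁; proj₂; swap; ∃; ∃-syntax)
open import Data.Product.Function.NonDependent.Propositional using (_×-↔_)
open import Data.Sum using (inj₂)
open import Function using (_∘_; Equivalence; Inverse; _↔_; _⇔_; mk⤖)
open import Function.Definitions using (Injective)
open import Function.Construct.Composition using (_↔-∘_)
open import Function.Construct.Identity using (↔-id)
open import Function.Properties.Bijection using (⤖⇒↔)
open import Relation.Binary.PropositionalEquality using (_≡_; refl; sym; trans; cong; cong₂; subst)
open import Relation.Nullary using (¬_; contradiction; yes; no)
open import Relation.Nullary.Decidable using (toWitness; fromWitness)
open import Algebra.Properties.CommutativeMonoid.Sum +-0-commutativeMonoid
  using (sum; sum-syntax; sum-cong-≗; sum-permute)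

variable
  m k s a a' b c a₁ a₂ a₃ b₁ b₂ b₃ c₁ c₂ c₃ : ℕ

∑-↑ : ∀ m {k} (f : Fin (m + k) → ℕ) → sum f ≡ sum (f ∘ (_↑ˡ k)) + sum (f ∘ (m ↑ʳ_))
∑-↑ zero    f = refl
∑-↑ (suc m) f = trans (cong (f 0F +_) (∑-↑ m (f ∘ suc))) (sym (+-assoc (f 0F) _ _))

∑-combine : ∀ m {k} (f : Fin (m * k) → ℕ) → sum f ≡ ∑[ i < m ] ∑[ j < k ] f (combine i j)
∑-combine zero    f = refl
∑-combine (suc m) {k} f =
  trans (∑-↑ k f) (cong (sum (f ∘ (_↑ˡ m * k)) +_) (∑-combine m (f ∘ (k ↑ʳ_))))

∑-remQuot : ∀ m {k} (f : Fin m × Fin k → ℕ) →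
  ∑[ c < m * k ] f (remQuot k c) ≡ ∑[ i < m ] ∑[ j < k ] f (i , j)
∑-remQuot m f =
  trans (∑-combine m _) (sum-cong-≗ λ i → sum-cong-≗ λ j → cong f (remQuot-combine i j))

∑-↔ : ∀ {n} (π : (Fin m × Fin k) ↔ Fin n) (f : Fin n → ℕ) →
  sum f ≡ ∑[ i < m ] ∑[ j < k ] f (Inverse.to π (i , j))
∑-↔ {m} π f = trans (sum-permute f (π ↔-∘ *↔×)) (∑-remQuot m (f ∘ Inverse.to π))

∣-sum : ∀ {d} {f : Fin m → ℕ} → (∀ i → d ∣ f i) → d ∣ sum f
∣-sum {zero}  _   = divides 0 refl
∣-sum {suc m} d∣f = ∣m∣n⇒∣m+n (d∣f 0F) (∣-sum (d∣f ∘ suc))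

partition↔ : ∀ {I X B : Set} {g : I → X → B} →
  (∀ a → Injective _≡_ _≡_ (g a)) → (∀ a b x y → g a x ≡ g b y → a ≡ b) →
  (∀ v → ∃[ a ] ∃[ x ] (g a x ≡ v)) →
  (I × X) ↔ B
partition↔ {g = g} g-inj disjoint covering = ⤖⇒↔ (mk⤖ (injective , surjective))
  where
  injective : Injective _≡_ _≡_ (λ (a , x) → g a x)
  injective {a , x} {b , y} eq with refl ← disjoint a b x y eq = cong (a ,_) (g-inj a eq)
  surjective : ∀ v → ∃ λ ax → ∀ {z} → z ≡ ax → g (proj₁ z) (proj₂ z) ≡ v
  surjective v with (a , x , eq) ← covering v = (a , x) , λ { refl → eq }

∣Empty∣≡0 : {S : Subset m} → Empty S → ∣ S ∣ ≡ 0
∣Empty∣≡0 {m} e = trans (cong ∣_∣ (Empty-unique e)) (∣⊥∣≡0 m)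

∣p∣>0⇒nonempty : {S : Subset m} → 0 < ∣ S ∣ → Nonempty S
∣p∣>0⇒nonempty {S = S} 0<∣S∣ with nonempty? S
... | yes ne = ne
... | no ¬ne = contradiction (subst (0 <_) (∣Empty∣≡0 ¬ne) 0<∣S∣) λ ()

subsingleton⇒∣p∣≤1 : {S : Subset m} → (∀ {x y} → x ∈ S → y ∈ S → x ≡ y) → ∣ S ∣ ≤ 1
subsingleton⇒∣p∣≤1 {S = []}          _    = z≤n
subsingleton⇒∣p∣≤1 {S = outside ∷ S} same =
  subsingleton⇒∣p∣≤1 λ x∈S y∈S → suc-injective (same (there x∈S) (there y∈S))
subsingleton⇒∣p∣≤1 {S = inside ∷ S}  same =
  s≤s (≤-reflexive (∣Empty∣≡0 λ (_ , y∈S) → contradiction (same here (there y∈S)) λ ()))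

∈partSet⁺ : ∀ {q : Fin m → Fin 3} {v j} → q v ≡ j → v ∈ partSet q j
∈partSet⁺ {v = v} qv≡j =
  lookup⇒[]= v _ (trans (lookup∘tabulate _ v) (Equivalence.to T-≡ (fromWitness qv≡j)))

∈partSet⁻ : ∀ {q : Fin m → Fin 3} {v j} → v ∈ partSet q j → q v ≡ j
∈partSet⁻ {v = v} v∈ =
  toWitness (Equivalence.from T-≡ (trans (sym (lookup∘tabulate _ v)) ([]=⇒lookup v∈)))

∈partSet-∘ : ∀ {n} (p : Fin n → Fin 3) (f : Fin m → Fin n) {i j} →
  i ∈ partSet (p ∘ f) j → f i ∈ partSet p j
∈partSet-∘ p f = ∈partSet⁺ ∘ ∈partSet⁻ {q = p ∘ f}

-- A part of a copy of D_s, recorded by the numbers of its vertices in V₁, V₂ and V₃.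
record Profile : Set where
  constructor ⟨_,_,_⟩
  field
    #V₁ #V₂ #V₃ : ℕ
open Profile

variable
  A B C : Profile

size : Profile → ℕ
size P = #V₁ P + (#V₂ P + #V₃ P)

weight : Profile → ℕ
weight P = #V₁ P + (#V₂ P + #V₂ P)

-- K_{a,b} fits inside a matching, i.e. a * b ≤ 1.
InMatching : ℕ → ℕ → Set
InMatching a b = (2 ≤ a → b ≡ 0) × (2 ≤ b → a ≡ 0)

record Consecutive (P Q : Profile) : Set where
  field
    no-V₂→V₁ : 0 < #V₂ P → #V₁ Q ≡ 0
    V₁→V₃    : InMatching (#V₁ P) (#V₃ Q)
    V₃→V₂    : InMatching (#V₃ P) (#V₂ Q)
open Consecutive

-- What the hypotheses force on the profiles of the parts A → B → C → A of a copy of D_s.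
record Footprint (s : ℕ) (A B C : Profile) : Set where
  field
    ∣A∣ : size A ≡ s
    ∣B∣ : size B ≡ s
    ∣C∣ : size C ≡ s
    A→B : Consecutive A B
    B→C : Consecutive B C
    C→A : Consecutive C A
open Footprint

rotate : Footprint s A B C → Footprint s B C A
rotate F = record
  { ∣A∣ = ∣B∣ F ; ∣B∣ = ∣C∣ F ; ∣C∣ = ∣A∣ F ; A→B = B→C F ; B→C = C→A F ; C→A = A→B F }

Balanced : Profile → Profile → Profile → Set
Balanced A B C = 3 ∣ weight A + (weight B + weight C)

Balanced-rotate : ∀ A B C → Balanced B C A → Balanced A B C
Balanced-rotate A B C =
  subst (3 ∣_) (trans (sym (+-assoc (weight B) (weight C) (weight A))) (+-comm _ (weight A)))

3∣x+[x+x] : ∀ x → 3 ∣ x + (x + x)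
3∣x+[x+x] x = subst (λ y → 3 ∣ x + (x + y)) (+-identityʳ x) (m∣m*n x)

-- Not reflexive, but transitive and antisymmetric for s ≥ 2: that is what forces equal counts
-- around the cycle of parts.
Bounds : ℕ → ℕ → ℕ → Set
Bounds s a b = (a ≡ 0 → b ≡ 0) × (2 ≤ b → a ≡ s)

bounds : 2 ≤ s → a + a' ≡ s → InMatching a' b → Bounds s a b
bounds {a = a} 2≤s a+a'≡s (a'-big , b-big) =
  (λ { refl → a'-big (subst (2 ≤_) (sym a+a'≡s) 2≤s) }) ,
  (λ 2≤b → trans (sym (+-identityʳ a)) (subst (λ x → a + x ≡ _) (b-big 2≤b) a+a'≡s))

Bounds-trans : 2 ≤ s → Bounds s a b → Bounds s b c → Bounds s a c
Bounds-trans 2≤s (ab₀ , ab₂) (bc₀ , bc₂) =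
  bc₀ ∘ ab₀ , λ 2≤c → ab₂ (subst (2 ≤_) (sym (bc₂ 2≤c)) 2≤s)

Bounds-antisym : 2 ≤ s → Bounds s a b → Bounds s b a → a ≡ b
Bounds-antisym {a = zero} _ (ab₀ , _) _ = sym (ab₀ refl)
Bounds-antisym {b = zero} _ _ (ba₀ , _) = ba₀ refl
Bounds-antisym {a = 1} {b = 1} _ _ _ = refl
Bounds-antisym {a = suc (suc _)} 2≤s (_ , ab₂) (_ , ba₂) =
  trans (ab₂ (subst (2 ≤_) (sym b≡s) 2≤s)) (sym b≡s)
  where b≡s = ba₂ (s≤s (s≤s z≤n))
Bounds-antisym {b = suc (suc _)} 2≤s (_ , ab₂) (_ , ba₂) =
  trans a≡s (sym (ba₂ (subst (2 ≤_) (sym a≡s) 2≤s)))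
  where a≡s = ab₂ (s≤s (s≤s z≤n))

constant-around-cycle : 2 ≤ s → Bounds s a b → Bounds s b c → Bounds s c a → a ≡ b × a ≡ c
constant-around-cycle 2≤s ab bc ca =
  Bounds-antisym 2≤s ab (Bounds-trans 2≤s bc ca) ,
  Bounds-antisym 2≤s (Bounds-trans 2≤s ab bc) ca

balanced-V₁-free : 2 ≤ s → Footprint s ⟨ 0 , a₂ , a₃ ⟩ ⟨ 0 , b₂ , b₃ ⟩ ⟨ 0 , c₂ , c₃ ⟩ →
  Balanced ⟨ 0 , a₂ , a₃ ⟩ ⟨ 0 , b₂ , b₃ ⟩ ⟨ 0 , c₂ , c₃ ⟩
balanced-V₁-free {a₂ = a₂} 2≤s F
  with refl , refl ← constant-around-cycle 2≤s (bounds 2≤s (∣A∣ F) (V₃→V₂ (A→B F)))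
                                               (bounds 2≤s (∣B∣ F) (V₃→V₂ (B→C F)))
                                               (bounds 2≤s (∣C∣ F) (V₃→V₂ (C→A F)))
  = 3∣x+[x+x] (a₂ + a₂)

balanced-V₂-free : 2 ≤ s → Footprint s ⟨ a₁ , 0 , a₃ ⟩ ⟨ b₁ , 0 , b₃ ⟩ ⟨ c₁ , 0 , c₃ ⟩ →
  Balanced ⟨ a₁ , 0 , a₃ ⟩ ⟨ b₁ , 0 , b₃ ⟩ ⟨ c₁ , 0 , c₃ ⟩
balanced-V₂-free {a₁ = a₁} 2≤s F
  with refl , refl ← constant-around-cycle 2≤s (bounds 2≤s (∣A∣ F) (swap (V₁→V₃ (C→A F))))
                                               (bounds 2≤s (∣C∣ F) (swap (V₁→V₃ (B→C F))))
                                               (bounds 2≤s (∣B∣ F) (swap (V₁→V₃ (A→B F))))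
  = 3∣x+[x+x] (a₁ + 0)

balanced-rainbow : 2 ≤ s → Footprint s ⟨ 0 , suc a₂ , a₃ ⟩ ⟨ 0 , 0 , b₃ ⟩ ⟨ suc c₁ , 0 , c₃ ⟩ →
  Balanced ⟨ 0 , suc a₂ , a₃ ⟩ ⟨ 0 , 0 , b₃ ⟩ ⟨ suc c₁ , 0 , c₃ ⟩
balanced-rainbow {a₂ = a₂} 2≤s F
  with refl ← Bounds-antisym 2≤s (bounds 2≤s (∣A∣ F) (swap (V₁→V₃ (C→A F))))
                                 (bounds 2≤s (∣C∣ F) (V₃→V₂ (C→A F)))
  = subst (3 ∣_) (sym (+-assoc (suc a₂) (suc a₂) (suc a₂ + 0))) (m∣m*n (suc a₂))

balanced-V₂-before-V₁ : 2 ≤ s →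
  Footprint s ⟨ a₁ , suc a₂ , a₃ ⟩ ⟨ 0 , b₂ , b₃ ⟩ ⟨ suc c₁ , c₂ , c₃ ⟩ →
  Balanced ⟨ a₁ , suc a₂ , a₃ ⟩ ⟨ 0 , b₂ , b₃ ⟩ ⟨ suc c₁ , c₂ , c₃ ⟩
balanced-V₂-before-V₁ {b₂ = suc _} _ F = contradiction (no-V₂→V₁ (B→C F) z<s) λ ()
balanced-V₂-before-V₁ {b₂ = zero} 2≤s F
  with refl ← proj₂ (V₁→V₃ (A→B F)) (subst (2 ≤_) (sym (∣B∣ F)) 2≤s)
     | refl ← proj₁ (V₃→V₂ (B→C F)) (subst (2 ≤_) (sym (∣B∣ F)) 2≤s)
  = balanced-rainbow 2≤s F

no-V₁-in-A : 2 ≤ s → Footprint s ⟨ a₁ , suc a₂ , a₃ ⟩ B ⟨ 0 , c₂ , c₃ ⟩ → a₁ ≡ 0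
no-V₁-in-A {c₂ = suc _} _   F = no-V₂→V₁ (C→A F) z<s
no-V₁-in-A {c₂ = zero}  2≤s F =
  contradiction (proj₁ (V₃→V₂ (C→A F)) (subst (2 ≤_) (sym (∣C∣ F)) 2≤s)) λ ()

balanced-V₂-first : 2 ≤ s → Footprint s ⟨ a₁ , suc a₂ , a₃ ⟩ B C → Balanced ⟨ a₁ , suc a₂ , a₃ ⟩ B C
balanced-V₂-first {C = ⟨ zero , _ , _ ⟩} 2≤s F
  with refl ← no-V₂→V₁ (A→B F) z<s | refl ← no-V₁-in-A 2≤s F = balanced-V₁-free 2≤s F
balanced-V₂-first {C = ⟨ suc _ , _ , _ ⟩} 2≤s F
  with refl ← no-V₂→V₁ (A→B F) z<s = balanced-V₂-before-V₁ 2≤s F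

balanced : 2 ≤ s → Footprint s A B C → Balanced A B C
balanced {A = ⟨ _ , suc _ , _ ⟩} 2≤s F = balanced-V₂-first 2≤s F
balanced {A = A} {B = B@(⟨ _ , suc _ , _ ⟩)} {C} 2≤s F =
  Balanced-rotate A B C (balanced-V₂-first 2≤s (rotate F))
balanced {A = A} {B} {C = C@(⟨ _ , suc _ , _ ⟩)} 2≤s F =
  Balanced-rotate A B C (Balanced-rotate B C A (balanced-V₂-first 2≤s (rotate (rotate F))))
balanced {A = ⟨ _ , zero , _ ⟩} {⟨ _ , zero , _ ⟩} {⟨ _ , zero , _ ⟩} 2≤s F = balanced-V₂-free 2≤s F

profileOf : (Fin m → Fin 3) → Profile
profileOf q = ⟨ ∣ partSet q 0F ∣ , ∣ partSet q 1F ∣ , ∣ partSet q 2F ∣ ⟩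

vertexWeight : Fin 3 → ℕ
vertexWeight 0F = 1
vertexWeight 1F = 2
vertexWeight 2F = 0

size-profileOf : (q : Fin m → Fin 3) → size (profileOf q) ≡ m
size-profileOf {zero}  q = refl
size-profileOf {suc m} q with q 0F | size-profileOf (q ∘ suc)
... | 0F | ih = cong suc ih
... | 1F | ih = trans (+-suc (#V₁ P) (#V₂ P + #V₃ P)) (cong suc ih)
  where P = profileOf (q ∘ suc)
... | 2F | ih =
  trans (cong (#V₁ P +_) (+-suc (#V₂ P) (#V₃ P))) (trans (+-suc (#V₁ P) (#V₂ P + #V₃ P)) (cong suc ih))
  where P = profileOf (q ∘ suc)

weight-profileOf : (q : Fin m → Fin 3) → sum (vertexWeight ∘ q) ≡ weight (profileOf q)
weight-profileOf {zero}  q = refl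
weight-profileOf {suc m} q with q 0F | weight-profileOf (q ∘ suc)
... | 0F | ih = cong suc ih
... | 1F | ih = trans (cong (2 +_) ih) (2+x+2y (#V₁ P) (#V₂ P))
  where
  P = profileOf (q ∘ suc)
  2+x+2y : ∀ x y → 2 + (x + (y + y)) ≡ x + (suc y + suc y)
  2+x+2y = solve-∀
... | 2F | ih = ih

profileOfPart : ∀ {n} → (Fin n → Fin 3) → (Fin 3 × Fin s → Fin n) → Fin 3 → Profile
profileOfPart p g P = profileOf (p ∘ g ∘ (P ,_))

biclique-in-matching : ∀ {n} {adj : Adj n} {p : Fin n → Fin 3} {j j'}
  {f : Fin m → Fin n} {h : Fin k → Fin n} →
  EdgesFormMatching adj (partSet p j) (partSet p j') →
  Injective _≡_ _≡_ f → Injective _≡_ _≡_ h → (∀ i i' → adj (f i) (h i') ≡ true) →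
  InMatching ∣ partSet (p ∘ f) j ∣ ∣ partSet (p ∘ h) j' ∣
biclique-in-matching {p = p} {j} {j'} {f} {h} (one-head , one-tail) f-inj h-inj edge =
  (λ 2≤a → n≤0⇒n≡0 (≮⇒≥ λ 0<b → <⇒≱ 2≤a (few-tails 0<b))) ,
  (λ 2≤b → n≤0⇒n≡0 (≮⇒≥ λ 0<a → <⇒≱ 2≤b (few-heads 0<a)))
  where
  tails = partSet (p ∘ f) j
  heads = partSet (p ∘ h) j'
  few-tails : 0 < ∣ heads ∣ → ∣ tails ∣ ≤ 1
  few-tails 0<b with (w , w∈) ← ∣p∣>0⇒nonempty 0<b = subsingleton⇒∣p∣≤1 λ i∈ i'∈ →
    f-inj (one-tail _ _ _ (∈partSet-∘ p f i∈) (∈partSet-∘ p f i'∈) (∈partSet-∘ p h w∈)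
                          (edge _ w) (edge _ w))
  few-heads : 0 < ∣ tails ∣ → ∣ heads ∣ ≤ 1
  few-heads 0<a with (u , u∈) ← ∣p∣>0⇒nonempty 0<a = subsingleton⇒∣p∣≤1 λ i∈ i'∈ →
    h-inj (one-head _ _ _ (∈partSet-∘ p f u∈) (∈partSet-∘ p h i∈) (∈partSet-∘ p h i'∈)
                          (edge u _) (edge u _))

no-edges-back : ∀ {n} {adj : Adj n} {p : Fin n → Fin 3} {f : Fin m → Fin n} {h : Fin k → Fin n} →
  IsTournament adj → (∀ u v → u ∈ partSet p 0F → v ∈ partSet p 1F → adj u v ≡ true) →
  (∀ i i' → adj (f i) (h i') ≡ true) →
  0 < ∣ partSet (p ∘ f) 1F ∣ → ∣ partSet (p ∘ h) 0F ∣ ≡ 0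
no-edges-back {p = p} {f} {h} tournament V₁⇒V₂ edge 0<a = n≤0⇒n≡0 (≮⇒≥ λ 0<b →
  let (i , i∈) = ∣p∣>0⇒nonempty 0<a
      (i' , i'∈) = ∣p∣>0⇒nonempty 0<b
  in contradiction (trans (sym (V₁⇒V₂ _ _ (∈partSet-∘ p h i'∈) (∈partSet-∘ p f i∈)))
                          (IsTournament.antisym tournament _ _ (edge i i'))) λ ())

module _ {n} {adj : Adj n} (tournament : IsTournament adj) (p : Fin n → Fin 3)
  (V₁⇒V₂ : ∀ u v → u ∈ partSet p 0F → v ∈ partSet p 1F → adj u v ≡ true)
  (M₃₂ : EdgesFormMatching adj (partSet p 2F) (partSet p 1F))
  (M₁₃ : EdgesFormMatching adj (partSet p 0F) (partSet p 2F))
  where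

  copy-footprint : {g : Fin 3 × Fin s → Fin n} → IsCopyOfD adj s g →
    Footprint s (profileOfPart p g 0F) (profileOfPart p g 1F) (profileOfPart p g 2F)
  copy-footprint {s} {g} (g-inj , g-edge) = record
    { ∣A∣ = size-profileOf _ ; ∣B∣ = size-profileOf _ ; ∣C∣ = size-profileOf _
    ; A→B = consecutive 0F ; B→C = consecutive 1F ; C→A = consecutive 2F }
    where
    part-inj : ∀ P → Injective _≡_ _≡_ (g ∘ (P ,_))
    part-inj P = cong proj₂ ∘ g-inj
    part-edge : ∀ P i i' → adj (g (P , i)) (g (next3 P , i')) ≡ true
    part-edge P i i' = g-edge (P , i) (next3 P , i') (inj₂ refl)
    consecutive : ∀ P → Consecutive (profileOfPart p g P) (profileOfPart p g (next3 P))
    consecutive P = record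
      { no-V₂→V₁ = no-edges-back tournament V₁⇒V₂ (part-edge P)
      ; V₁→V₃    = biclique-in-matching M₁₃ (part-inj P) (part-inj (next3 P)) (part-edge P)
      ; V₃→V₂    = biclique-in-matching M₃₂ (part-inj P) (part-inj (next3 P)) (part-edge P) }

  copy-weight-divisible : {g : Fin 3 × Fin s → Fin n} → 2 ≤ s → IsCopyOfD adj s g →
    3 ∣ ∑[ P < 3 ] ∑[ i < s ] vertexWeight (p (g (P , i)))
  copy-weight-divisible {s} {g} 2≤s copy =
    subst (3 ∣_) (sym weight-sum) (balanced 2≤s (copy-footprint copy))
    where
    w : Fin 3 → ℕ
    w P = weight (profileOfPart p g P)
    weight-sum : ∑[ P < 3 ] ∑[ i < s ] vertexWeight (p (g (P , i))) ≡ w 0F + (w 1F + w 2F)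
    weight-sum = trans (sum-cong-≗ λ P → weight-profileOf (p ∘ g ∘ (P ,_)))
                       (cong (λ x → w 0F + (w 1F + x)) (+-identityʳ (w 2F)))

  tiling-weight-divisible : 2 ≤ s → HasPerfectDTiling adj s → 3 ∣ sum (vertexWeight ∘ p)
  tiling-weight-divisible {s} 2≤s (t , g , copies , disjoint , covering) =
    subst (3 ∣_) (sym weight-sum) (∣-sum λ a → copy-weight-divisible 2≤s (copies a))
    where
    π : (Fin t × Fin (3 * s)) ↔ Fin n
    π = partition↔ (proj₁ ∘ copies) disjoint covering ↔-∘ (↔-id (Fin t) ×-↔ *↔×)
    weight-sum : sum (vertexWeight ∘ p) ≡ ∑[ a < t ] ∑[ P < 3 ] ∑[ i < s ] vertexWeight (p (g a (P , i)))
    weight-sum =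
      trans (∑-↔ π (vertexWeight ∘ p)) (sum-cong-≗ λ a → ∑-remQuot 3 (vertexWeight ∘ p ∘ g a))

3∤[n∸1]+[n+n] : ∀ {n} → 0 < n → ¬ 3 ∣ (n ∸ 1) + (n + n)
3∤[n∸1]+[n+n] {suc n} _ 3∣ =
  contradiction (∣⇒≤ (∣m+n∣m⇒∣n (subst (3 ∣_) (3n+2 n) 3∣) (m∣m*n n))) λ { (s≤s (s≤s ())) }
  where
  3n+2 : ∀ n → n + (suc n + suc n) ≡ 3 * n + 2
  3n+2 = solve-∀

proposition3p2 : (s k : ℕ) → 2 ≤ s → 2 ∣ (s * suc k) →
  (n : ℕ) → (adj : Adj n) → IsTournament adj →
  (p : Fin n → Fin 3) →
  let V₁ = partSet p zero
      V₂ = partSet p (suc zero)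
      V₃ = partSet p (suc (suc zero))
      N = s * suc k
  in
  ∣ V₁ ∣ ≡ N ∸ 1 →
  ∣ V₂ ∣ ≡ N →
  ∣ V₃ ∣ ≡ N + 1 →
  SemiRegularOn adj V₁ →
  SemiRegularOn adj V₂ →
  SemiRegularOn adj V₃ →
  (∀ u v → u ∈ V₁ → v ∈ V₂ → adj u v ≡ true) →
  EdgesFormMatching adj V₃ V₂ →
  EdgesFormMatching adj V₁ V₃ →
  tailsFromTo adj V₃ V₂ ≡ headsFromTo adj V₁ V₃ →
  ∣ headsFromTo adj V₃ V₂ ∣ ≡ N / 2 →
  ∣ tailsFromTo adj V₃ V₂ ∣ ≡ N / 2 →
  ∣ tailsFromTo adj V₁ V₃ ∣ ≡ N / 2 →
  (∀ u → u ∈ V₂ →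
    (u ∈ headsFromTo adj V₃ V₂ ⇔ (∀ w → w ∈ V₂ → outDegIn adj V₂ w ≤ outDegIn adj V₂ u))) →
  ¬ HasPerfectDTiling adj s
proposition3p2 s k 2≤s _ n adj tournament p ∣V₁∣ ∣V₂∣ _ _ _ _ V₁⇒V₂ M₃₂ M₁₃ _ _ _ _ _ tiling =
  3∤[n∸1]+[n+n] 0<N (subst (3 ∣_) total-weight (tiling-weight-divisible tournament p V₁⇒V₂ M₃₂ M₁₃ 2≤s tiling))
  where
  0<N : 0 < s * suc k
  0<N = ≤-trans (≤-trans (s≤s z≤n) 2≤s) (m≤m*n s (suc k))
  total-weight : sum (vertexWeight ∘ p) ≡ (s * suc k ∸ 1) + (s * suc k + s * suc k)
  total-weight = trans (weight-profileOf p) (cong₂ (λ x y → x + (y + y)) ∣V₁∣ ∣V₂∣)
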